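{- For the directed path $P_n=(v_1,v_2,\dots,v_n)$ (arcs $v_iv_{i+1}$), $n\ge 1$, $\gamma_{os}(P_n)=\lceil n/2\rceil$.
   Context: For a digraph $D=(V,A)$ with underlying graph $G$ (vertices $u,v$ adjacent iff $uv\in A$ or $vu\in A$), $S\subseteq V$ is dominating in $G$ if every vertex outside $S$ has a neighbor in $S$. $S$ is an out-secure dominating set (OSDS) of $D$ if $S$ is dominating in $G$ and for every $v\in V\setminus S$ there is an in-neighbor $u\in S$ of $v$ (arc $uv\in A$) such that $(S\setminus\{u\})\cup\{v\}$ is dominating in $G$; $\gamma_{os}(D)$ is the minimum size of an OSDS of $D$. -}

module Defs where

open import Data.Nat using (ℕ; suc; _≤_; _+_; _/_)
open import Data.Fin using (Fin; toℕ)
open import Data.Fin.Subset using (Subset; _∈_; _∉_; ∣_∣)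
open import Data.Vec using (_[_]≔_)
open import Data.Bool using (false; true)
open import Data.Product using (_×_; ∃-syntax)
open import Data.Sum using (_⊎_)
open import Relation.Binary.PropositionalEquality using (_≡_)

record Digraph (n : ℕ) : Set₁ where
  field
    Arc : Fin n → Fin n → Set

open Digraph public

Adj : ∀ {n} → Digraph n → Fin n → Fin n → Set
Adj D u v = Arc D u v ⊎ Arc D v u

Dominating : ∀ {n} → Digraph n → Subset n → Set
Dominating {n} D S = (v : Fin n) → v ∉ S → ∃[ u ] (u ∈ S × Adj D u v)

swap : ∀ {n} → Subset n → Fin n → Fin n → Subset n
swap S u v = (S [ u ]≔ false) [ v ]≔ true

IsOSDS : ∀ {n} → Digraph n → Subset n → Set
IsOSDS {n} D S =
  Dominating D S ×
  ((v : Fin n) → v ∉ S →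
     ∃[ u ] (u ∈ S × Arc D u v × Dominating D (swap S u v)))

IsGammaOS : ∀ {n} → Digraph n → ℕ → Set
IsGammaOS {n} D k =
  (∃[ S ] (IsOSDS D S × ∣ S ∣ ≡ k)) ×
  ((S : Subset n) → IsOSDS D S → k ≤ ∣ S ∣)

-- directed path v₁ → v₂ → … → vₙ, with vᵢ represented by index i-1
DirectedPath : (n : ℕ) → Digraph n
DirectedPath n = record { Arc = λ i j → toℕ j ≡ suc (toℕ i) }

ceilHalf : ℕ → ℕ
ceilHalf m = (m + 1) / 2

-- On a directed path every vertex has at most one out-neighbour, and the only in-neighbour of a
-- vertex is its predecessor. Hence a set is out-secure dominating exactly when it contains the
-- first vertex and the predecessor of each vertex it misses. Such a set never misses two
-- consecutive vertices, so it has at least ⌈n/2⌉ elements, and the alternating set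
-- v₁, v₃, v₅, … has exactly that many.
module Submission where

open import Defs
open import Data.Nat using (ℕ; zero; suc; _+_; _*_; _≤_; _≥_; z≤n; s≤s)
open import Data.Nat.Properties
  using (≤-pred; m≤n⇒m≤1+n; +-suc; +-comm; *-suc; *-identityʳ; n<1+n; suc-injective; module ≤-Reasoning)
open import Data.Nat.DivMod using (m<n*o⇒m/o<n; m/n≡1+[m∸n]/n)
open import Data.Fin using (Fin; toℕ; inject₁) renaming (zero to fzero; suc to fsuc)
open import Data.Fin.Properties using (toℕ-injective; toℕ-inject₁; _≟_)
open import Data.Fin.Subset using (Subset; _∈_; _∉_; ∣_∣)
open import Data.Fin.Subset.Properties using (drop-there)
open import Data.Vec using (_∷_; []; here; there; _[_]≔_)
open import Data.Vec.Properties using ([]≔-updates; []≔-minimal)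
open import Data.Bool using (Bool; true; false; not)
open import Data.Product using (_×_; _,_; ∃-syntax)
open import Data.Sum using (inj₁; inj₂)
open import Data.Empty using (⊥-elim)
open import Function using (_∘_)
open import Relation.Nullary using (yes; no)
open import Relation.Binary.PropositionalEquality using (_≡_; _≢_; refl; sym; trans; cong; subst)

private
  variable
    n : ℕ

OutDominating : Digraph n → Subset n → Set
OutDominating {n} D S = (v : Fin n) → v ∉ S → ∃[ u ] (u ∈ S × Arc D u v)

OutFunctional : Digraph n → Set
OutFunctional {n} D = {u v w : Fin n} → Arc D u v → Arc D u w → v ≡ w

outDominating⇒dominating : {D : Digraph n} {S : Subset n} → OutDominating D S → Dominating D S
outDominating⇒dominating outDom v v∉S with outDom v v∉S
... | u , u∈S , u→v = u , u∈S , inj₁ u→v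

isOSDS⇒outDominating : {D : Digraph n} {S : Subset n} → IsOSDS D S → OutDominating D S
isOSDS⇒outDominating (_ , secure) v v∉S with secure v v∉S
... | u , u∈S , u→v , _ = u , u∈S , u→v

∈-swap-new : (S : Subset n) (u v : Fin n) → v ∈ swap S u v
∈-swap-new S u v = []≔-updates (S [ u ]≔ false) v

∈-swap-kept : {S : Subset n} {u w : Fin n} (v : Fin n) → w ∈ S → w ≢ u → w ∈ swap S u v
∈-swap-kept {S = S} {u} {w} v w∈S w≢u with w ≟ v
... | yes refl = ∈-swap-new S u w
... | no w≢v = []≔-minimal _ w v w≢v ([]≔-minimal S w u w≢u w∈S)

-- Out-degree at most one means that swapping out the in-neighbour u of v loses no dominator:
-- any other missed vertex has an in-neighbour in S, and it is not u since u's only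
-- out-neighbour is v.
outDominating⇒isOSDS : {D : Digraph n} {S : Subset n} →
                       OutFunctional D → OutDominating D S → IsOSDS D S
outDominating⇒isOSDS {n} {D} {S} functional outDom = outDominating⇒dominating outDom , secure
  where
  secure : (v : Fin n) → v ∉ S → ∃[ u ] (u ∈ S × Arc D u v × Dominating D (swap S u v))
  secure v v∉S with outDom v v∉S
  ... | u , u∈S , u→v = u , u∈S , u→v , swapDominating
    where
    swapDominating : Dominating D (swap S u v)
    swapDominating x x∉swap with x ≟ u
    ... | yes refl = v , ∈-swap-new S u v , inj₂ u→v
    ... | no x≢u with outDom x (x∉swap ∘ λ x∈S → ∈-swap-kept v x∈S x≢u)
    ...   | w , w∈S , w→x = w , ∈-swap-kept v w∈S w≢u , inj₁ w→x
      where
      w≢u : w ≢ u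
      w≢u refl with functional w→x u→v
      ... | refl = x∉swap (∈-swap-new S u v)

directedPath-outFunctional : OutFunctional (DirectedPath n)
directedPath-outFunctional u→v u→w = toℕ-injective (trans u→v (sym u→w))

-- Out-domination of the directed path, extended by a virtual vertex in front of the first
-- one whose membership is b: position inject₁ j of b ∷ S is the predecessor of position j of S.
PathOutDominating : Bool → Subset n → Set
PathOutDominating {n} b S = (j : Fin n) → j ∉ S → inject₁ j ∈ b ∷ S

outDominating⇒pathOutDominating : {S : Subset n} →
                                  OutDominating (DirectedPath n) S → PathOutDominating false S
outDominating⇒pathOutDominating {S = S} outDom j j∉S with outDom j j∉S
outDominating⇒pathOutDominating {S = S} outDom fzero    _ | _ , _ , ()
outDominating⇒pathOutDominating {S = S} outDom (fsuc j) _ | u , u∈S , u→j =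
  there (subst (_∈ S) u≡pred u∈S)
  where
  u≡pred : u ≡ inject₁ j
  u≡pred = toℕ-injective (trans (sym (suc-injective u→j)) (sym (toℕ-inject₁ j)))

pathOutDominating⇒outDominating : {S : Subset n} →
                                  PathOutDominating false S → OutDominating (DirectedPath n) S
pathOutDominating⇒outDominating pathOutDom fzero j∉S with pathOutDom fzero j∉S
... | ()
pathOutDominating⇒outDominating pathOutDom (fsuc j) j∉S =
  inject₁ j , drop-there (pathOutDom (fsuc j) j∉S) , cong suc (sym (toℕ-inject₁ j))

pathOutDominating-tail : {b x : Bool} {S : Subset n} →
                         PathOutDominating b (x ∷ S) → PathOutDominating x S
pathOutDominating-tail pathOutDom j j∉S = drop-there (pathOutDom (fsuc j) (j∉S ∘ drop-there))

pathOutDominating-size : (b : Bool) (S : Subset n) → PathOutDominating b S → n ≤ ∣ S ∣ + ∣ b ∷ S ∣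
pathOutDominating-size b [] _ = z≤n
pathOutDominating-size false (true ∷ S) pathOutDom =
  s≤s (pathOutDominating-size true S (pathOutDominating-tail pathOutDom))
pathOutDominating-size {suc n} true (true ∷ S) pathOutDom =
  subst (suc n ≤_) (sym (+-suc (suc ∣ S ∣) (suc ∣ S ∣)))
    (m≤n⇒m≤1+n (s≤s (pathOutDominating-size true S (pathOutDominating-tail pathOutDom))))
pathOutDominating-size {suc n} b (false ∷ S) pathOutDom with pathOutDom fzero (λ ())
... | here = subst (suc n ≤_) (sym (+-suc ∣ S ∣ ∣ S ∣))
               (s≤s (pathOutDominating-size false S (pathOutDominating-tail pathOutDom)))

ceilHalf-≤ : {m c : ℕ} → m ≤ c + c → ceilHalf m ≤ c
ceilHalf-≤ {m} {c} m≤c+c = ≤-pred (m<n*o⇒m/o<n (begin-strict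
  m + 1              ≡⟨ +-comm m 1 ⟩
  suc m              ≤⟨ s≤s m≤c+c ⟩
  suc (c + c)        <⟨ n<1+n _ ⟩
  suc (suc (c + c))  ≡⟨ cong (suc ∘ suc) (sym c*2≡c+c) ⟩
  suc c * 2          ∎))
  where
  open ≤-Reasoning
  c*2≡c+c : c * 2 ≡ c + c
  c*2≡c+c = trans (*-suc c 1) (cong (c +_) (*-identityʳ c))

ceilHalf-suc-suc : (m : ℕ) → ceilHalf (suc (suc m)) ≡ suc (ceilHalf m)
ceilHalf-suc-suc m = m/n≡1+[m∸n]/n {suc (suc m) + 1} {2} (s≤s (s≤s z≤n))

alternating : Bool → (n : ℕ) → Subset n
alternating b zero    = []
alternating b (suc n) = b ∷ alternating (not b) n

∣alternating-true∣ : (n : ℕ) → ∣ alternating true n ∣ ≡ ceilHalf n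
∣alternating-true∣ zero          = refl
∣alternating-true∣ (suc zero)    = refl
∣alternating-true∣ (suc (suc n)) = trans (cong suc (∣alternating-true∣ n)) (sym (ceilHalf-suc-suc n))

pathOutDominating-alternating : (b : Bool) → PathOutDominating (not b) (alternating b n)
pathOutDominating-alternating true  fzero    j∉S = ⊥-elim (j∉S here)
pathOutDominating-alternating false fzero    _   = here
pathOutDominating-alternating true  (fsuc j) j∉S =
  there (pathOutDominating-alternating false j (j∉S ∘ there))
pathOutDominating-alternating false (fsuc j) j∉S =
  there (pathOutDominating-alternating true j (j∉S ∘ there))

directedPath-isOSDS⇒ceilHalf≤ : (S : Subset n) → IsOSDS (DirectedPath n) S → ceilHalf n ≤ ∣ S ∣
directedPath-isOSDS⇒ceilHalf≤ S osds = ceilHalf-≤ (pathOutDominating-size false S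
  (outDominating⇒pathOutDominating (isOSDS⇒outDominating osds)))

directedPath-isOSDS-alternating : (n : ℕ) → IsOSDS (DirectedPath n) (alternating true n)
directedPath-isOSDS-alternating n = outDominating⇒isOSDS directedPath-outFunctional
  (pathOutDominating⇒outDominating (pathOutDominating-alternating true))

proposition3p9 : (n : ℕ) → n ≥ 1 → IsGammaOS (DirectedPath n) (ceilHalf n)
proposition3p9 n _ =
  (alternating true n , directedPath-isOSDS-alternating n , ∣alternating-true∣ n) ,
  directedPath-isOSDS⇒ceilHalf≤
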